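{- Let $n \ge 1$ and $k \ge 3$ be integers, and let $$S := \left\langle \left\{ \frac{(n+i)\,(n + (i \bmod 2) + 1)}{2} : 0 \le i \le k \right\}\right\rangle,$$ where $i \bmod 2 \in \{0,1\}$ is the residue of $i$ modulo $2$. Then $S$ is a numerical semigroup, and with $T_m := \frac{m(m+1)}{2}$, $$F(S) = \begin{cases} \left\lceil \dfrac{n-2}{2\lfloor k/2\rfloor}\right\rceil T_n + \left\lceil \dfrac{n}{\lfloor (k-1)/2\rfloor}\right\rceil T_{n+1} + n^2 + n - 1, & \text{if } n \text{ is even},\\[8pt] \left\lceil \dfrac{n-1}{\lfloor k/2\rfloor}\right\rceil T_n + \left\lceil \dfrac{n-1}{2\lfloor (k-1)/2\rfloor}\right\rceil T_{n+1} + n^2 - 2, & \text{if } n \text{ is odd}.\end{cases}$$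
   Context: $\mathbb{N}$ denotes the nonnegative integers. For a set $A$ of positive integers, $\langle A\rangle$ is the submonoid of $(\mathbb{N},+)$ generated by $A$. A numerical semigroup is a submonoid $S\subseteq\mathbb{N}$ with $\mathbb{N}\setminus S$ finite; its Frobenius number $F(S)$ is the largest integer not in $S$ (with $F(\mathbb{N})=-1$). -}

module Defs where

open import Data.Nat using (ℕ; zero; suc; _+_; _*_; _∸_; _≤_; _≥_)
open import Data.Nat.DivMod using (_/_; _%_)
open import Data.Integer as ℤ using (ℤ; +_; -[1+_])
open import Data.Product using (Σ; _×_; ∃)
open import Relation.Binary.PropositionalEquality using (_≡_)
open import Relation.Nullary using (¬_)

data ⟨_⟩ (A : ℕ → Set) : ℕ → Set where
  ⟨0⟩   : ⟨ A ⟩ 0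
  ⟨gen⟩ : ∀ {a} → A a → ⟨ A ⟩ a
  ⟨+⟩   : ∀ {a b} → ⟨ A ⟩ a → ⟨ A ⟩ b → ⟨ A ⟩ (a + b)

record IsNumericalSemigroup (S : ℕ → Set) : Set where
  field
    contains-0  : S 0
    closed-+    : ∀ a b → S a → S b → S (a + b)
    cofinite    : ∃ λ N → ∀ m → m ≥ N → S m

-- f is the Frobenius number of S: the largest integer not in S
-- (f = -1 when S = ℕ).
record IsFrobeniusNumber (S : ℕ → Set) (f : ℤ) : Set where
  field
    ≥-1        : -[1+ 0 ] ℤ.≤ f
    not-in     : ∀ m → + m ≡ f → ¬ S m
    above-in   : ∀ m → f ℤ.< + m → S m

-- ceiling division ⌈a / b⌉ for b > 0 (value at b = 0 is irrelevant).
ceilDiv : ℕ → ℕ → ℕ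
ceilDiv a zero    = 0
ceilDiv a (suc b) = (a + b) / suc b

T : ℕ → ℕ
T m = (m * suc m) / 2

gen : ℕ → ℕ → ℕ
gen n i = ((n + i) * (n + i % 2 + 1)) / 2

Gens : ℕ → ℕ → ℕ → Set
Gens n k a = Σ ℕ λ i → i ≤ k × a ≡ gen n i

Sg : ℕ → ℕ → ℕ → Set
Sg n k = ⟨ Gens n k ⟩

frob : ℕ → ℕ → ℤ
frob n k with n % 2
... | zero  = + (ceilDiv (n ∸ 2) (2 * (k / 2)) * T n
               + ceilDiv n ((k ∸ 1) / 2) * T (suc n)
               + n * n + n) ℤ.- + 1
... | suc _ = + (ceilDiv (n ∸ 1) (k / 2) * T n
               + ceilDiv (n ∸ 1) (2 * ((k ∸ 1) / 2)) * T (suc n)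
               + n * n) ℤ.- + 2

module Submission where

-- Splitting the generators by the parity of i gives the progressions T n + j (n+1), j ≤ ⌊k/2⌋,
-- and T (n+1) + j (n+2), j ≤ ⌊(k-1)/2⌋, so S consists of the numbers
-- x T n + y T (n+1) + u (n+1) + v (n+2) with u ≤ x ⌊k/2⌋ and v ≤ y ⌊(k-1)/2⌋.
-- For n = 2m both triangular numbers are multiples of d = n + 1; for n = 2m + 1 they are
-- 1 and 0 modulo e = n + 2. Reducing modulo d (resp. e) turns membership into a question
-- about sums of t elements of an interval [m, m + P]: these cover every c ≥ Z m as soon as
-- m - 1 ≤ Z P, and miss Z m - 1 when Z P < m - 1 + P. The least such Z is a ceiling
-- quotient, which is where the ceilings in the formula come from.

open import Defs
open import Data.Nat
open import Data.Nat.Properties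
open import Data.Nat.DivMod
open import Data.Nat.Divisibility using (divides-refl)
open import Data.Nat.Tactic.RingSolver using (solve-∀)
open import Data.Product using (∃; ∃₂; _×_; _,_; proj₁; proj₂)
open import Relation.Nullary using (¬_; yes; no; contradiction)
open import Relation.Binary.PropositionalEquality
import Data.Integer as ℤ
import Data.Integer.Properties as ℤP

divMod-unique : ∀ {d} .{{_ : NonZero d}} {r r′ a b} → r < d → r′ < d →
                r + a * d ≡ r′ + b * d → r ≡ r′ × a ≡ b
divMod-unique {d} {r} {r′} {a} {b} r<d r′<d eq =
  r≡r′ , *-cancelʳ-≡ a b d (+-cancelˡ-≡ r _ _ (trans eq (cong (_+ b * d) (sym r≡r′))))
  where
  open ≡-Reasoning
  r≡r′ : r ≡ r′
  r≡r′ = begin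
    r                ≡⟨ m<n⇒m%n≡m r<d ⟨
    r % d            ≡⟨ [m+kn]%n≡m%n r a d ⟨
    (r + a * d) % d  ≡⟨ cong (_% d) eq ⟩
    (r′ + b * d) % d ≡⟨ [m+kn]%n≡m%n r′ b d ⟩
    r′ % d           ≡⟨ m<n⇒m%n≡m r′<d ⟩
    r′               ∎

m*d≡n*d+r⇒∃[j]m≡n+j×r≡j*d : ∀ m n d .{{_ : NonZero d}} {r} → m * d ≡ n * d + r →
                              ∃ λ j → m ≡ n + j × r ≡ j * d
m*d≡n*d+r⇒∃[j]m≡n+j×r≡j*d m n d {r} eq = m ∸ n , sym (m+[n∸m]≡n n≤m) , (begin
  r                 ≡⟨ m+n∸m≡n (n * d) r ⟨
  n * d + r ∸ n * d ≡⟨ cong (_∸ n * d) eq ⟨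
  m * d ∸ n * d     ≡⟨ *-distribʳ-∸ d m n ⟨
  (m ∸ n) * d       ∎)
  where
  open ≡-Reasoning
  n≤m : n ≤ m
  n≤m = *-cancelʳ-≤ n m d (subst (n * d ≤_) (sym eq) (m≤m+n (n * d) r))

b*e≤r+c*e⇒b≤c : ∀ {b c r e} → r < e → b * e ≤ r + c * e → b ≤ c
b*e≤r+c*e⇒b≤c {b} {c} {r} {e} r<e be≤r+ce with b ≤? c
... | yes b≤c = b≤c
... | no b≰c = contradiction (begin-strict
  b * e     ≤⟨ be≤r+ce ⟩
  r + c * e <⟨ +-monoˡ-< (c * e) r<e ⟩
  suc c * e ≤⟨ *-monoˡ-≤ e (≰⇒> b≰c) ⟩
  b * e     ∎) (<-irrefl refl)
  where open ≤-Reasoning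

z*[1+m]≡1+t*[1+m]+v⇒m≤v×t<z : ∀ {m z t v} → z * suc m ≡ suc (t * suc m + v) → m ≤ v × t < z
z*[1+m]≡1+t*[1+m]+v⇒m≤v×t<z {m} {z} {t} {v} eq = m≤v , t<z
  where
  m≤v : m ≤ v
  m≤v with m ≤? v
  ... | yes m≤v = m≤v
  ... | no m≰v = contradiction (proj₁ (divMod-unique {suc m} {0} {suc v} {z} {t} (s≤s z≤n) (s≤s (≰⇒> m≰v))
                   (trans eq (cong suc (+-comm (t * suc m) v))))) 0≢1+n
  t<z : t < z
  t<z = *-cancelʳ-< (suc m) t z (≤-trans (s≤s (m≤m+n (t * suc m) v)) (≤-reflexive (sym eq)))

record IsCeiling (a b c : ℕ) : Set where
  field
    lower : a ≤ c * b
    upper : c * b < a + b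

ceilDiv-isCeiling : ∀ a b → 1 ≤ b → IsCeiling a b (ceilDiv a b)
ceilDiv-isCeiling a (suc b) _ = record { lower = lower ; upper = upper }
  where
  open ≤-Reasoning
  c = (a + b) / suc b
  lower : a ≤ c * suc b
  lower = +-cancelʳ-≤ b a (c * suc b) (begin
    a + b                       ≡⟨ m≡m%n+[m/n]*n (a + b) (suc b) ⟩
    (a + b) % suc b + c * suc b ≤⟨ +-monoˡ-≤ (c * suc b) (≤-pred (m%n<n (a + b) (suc b))) ⟩
    b + c * suc b               ≡⟨ +-comm b _ ⟩
    c * suc b + b               ∎)
  upper : c * suc b < a + suc b
  upper = begin-strict
    c * suc b ≤⟨ m/n*n≤m (a + b) (suc b) ⟩
    a + b     <⟨ +-monoʳ-< a (n<1+n b) ⟩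
    a + suc b ∎

isCeiling-cancel : ∀ {a b c} k .{{_ : NonZero k}} → IsCeiling (a * k) (k * b) c → IsCeiling a b c
isCeiling-cancel {a} {b} {c} k ceil = record
  { lower = *-cancelʳ-≤ a (c * b) k (subst (a * k ≤_) (c*[k*b]≡c*b*k c k b) lower)
  ; upper = *-cancelʳ-< k (c * b) (a + b) (subst₂ _<_ (c*[k*b]≡c*b*k c k b) (a*k+k*b≡[a+b]*k a k b) upper)
  }
  where
  open IsCeiling ceil
  c*[k*b]≡c*b*k : ∀ c k b → c * (k * b) ≡ c * b * k
  c*[k*b]≡c*b*k = solve-∀
  a*k+k*b≡[a+b]*k : ∀ a k b → a * k + k * b ≡ (a + b) * k
  a*k+k*b≡[a+b]*k = solve-∀

isCeiling-minimal : ∀ {a b c y} → IsCeiling a b c → a ≤ y * b → c ≤ y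
isCeiling-minimal {a} {b} {c} {y} ceil a≤yb with c ≤? y
... | yes c≤y = c≤y
... | no c≰y = contradiction (begin-strict
  a + b     ≤⟨ +-monoˡ-≤ b a≤yb ⟩
  y * b + b ≡⟨ +-comm (y * b) b ⟩
  suc y * b ≤⟨ *-monoˡ-≤ b (≰⇒> c≰y) ⟩
  c * b     <⟨ IsCeiling.upper ceil ⟩
  a + b     ∎) (<-irrefl refl)
  where open ≤-Reasoning

isCeiling⇒NonZero : ∀ {a b c} → IsCeiling a b c → NonZero b
isCeiling⇒NonZero {b = suc _} _ = _
isCeiling⇒NonZero {a} {zero} ceil =
  contradiction (≤-<-trans (IsCeiling.lower ceil) (IsCeiling.upper ceil)) (<-irrefl (sym (+-identityʳ a)))

-- c is a sum of t elements of the interval [m, m + P]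
IntervalSum : ℕ → ℕ → ℕ → Set
IntervalSum m P c = ∃₂ λ t w → w ≤ t * P × c ≡ t * m + w

intervalSum-≥ : ∀ {m P Z c} → m ≤ Z * P → Z * suc m ≤ c → IntervalSum (suc m) P c
intervalSum-≥ {m} {P} {Z} {c} m≤ZP Zm≤c =
  c / suc m , c % suc m , w≤tP , trans (m≡m%n+[m/n]*n c (suc m)) (+-comm (c % suc m) _)
  where
  Z≤t : Z ≤ c / suc m
  Z≤t = subst (_≤ c / suc m) (m*n/n≡m Z (suc m)) (/-monoˡ-≤ (suc m) Zm≤c)
  w≤tP : c % suc m ≤ c / suc m * P
  w≤tP = ≤-trans (≤-pred (m%n<n c (suc m))) (≤-trans m≤ZP (*-monoˡ-≤ P Z≤t))

intervalSum-gap : ∀ {m P Z c} → Z * P < m + P → suc c ≡ Z * suc m → ¬ IntervalSum (suc m) P c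
intervalSum-gap {m} {P} {Z} ZP<m+P eq (t , w , w≤tP , refl) with Z ≤? t
... | yes Z≤t = <-irrefl refl (begin-strict
  t * suc m + w       <⟨ n<1+n _ ⟩
  suc (t * suc m + w) ≡⟨ eq ⟩
  Z * suc m           ≤⟨ *-monoˡ-≤ (suc m) Z≤t ⟩
  t * suc m           ≤⟨ m≤m+n _ w ⟩
  t * suc m + w       ∎)
  where open ≤-Reasoning
... | no Z≰t = <-irrefl refl (begin-strict
  Z * suc m           ≡⟨ eq ⟨
  suc (t * suc m + w) ≡⟨ cong suc (+-comm _ w) ⟩
  suc w + t * suc m   ≤⟨ +-monoˡ-≤ _ w<m ⟩
  m + t * suc m       <⟨ n<1+n _ ⟩
  suc t * suc m       ≤⟨ *-monoˡ-≤ (suc m) (≰⇒> Z≰t) ⟩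
  Z * suc m           ∎)
  where
  open ≤-Reasoning
  tP<m : t * P < m
  tP<m = +-cancelʳ-< P (t * P) m (begin-strict
    t * P + P ≡⟨ +-comm _ P ⟩
    suc t * P ≤⟨ *-monoˡ-≤ P (≰⇒> Z≰t) ⟩
    Z * P     <⟨ ZP<m+P ⟩
    m + P     ∎)
  w<m : w < m
  w<m = ≤-<-trans w≤tP tP<m

isNumericalSemigroup-⟨⟩ : ∀ {G : ℕ → Set} N → (∀ s → N ≤ s → ⟨ G ⟩ s) → IsNumericalSemigroup ⟨ G ⟩
isNumericalSemigroup-⟨⟩ N above =
  record { contains-0 = ⟨0⟩ ; closed-+ = λ _ _ → ⟨+⟩ ; cofinite = N , above }

isFrobeniusNumber-+ : ∀ {S : ℕ → Set} {f} → ¬ S f → (∀ s → f < s → S s) → IsFrobeniusNumber S (ℤ.+ f)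
isFrobeniusNumber-+ {S} f∉S above = record
  { ≥-1      = ℤ.-≤+
  ; not-in   = λ s s≡f → subst (λ s → ¬ S s) (sym (ℤP.+-injective s≡f)) f∉S
  ; above-in = λ { s (ℤ.+<+ f<s) → above s f<s }
  }

isFrobeniusNumber-ℕ : ∀ {S : ℕ → Set} → (∀ s → S s) → IsFrobeniusNumber S ℤ.-[1+ 0 ]
isFrobeniusNumber-ℕ all = record { ≥-1 = ℤP.≤-refl ; not-in = λ _ () ; above-in = λ s _ → all s }

-- s = (x A + u C) + (y B + v D): a sum of x terms of A, A + C, …, A + p C
-- and of y terms of B, B + D, …, B + q D
record Combination (A B C D p q s : ℕ) : Set where
  constructor combination
  field
    x y u v : ℕ
    u≤x*p   : u ≤ x * p
    v≤y*q   : v ≤ y * q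
    s≡      : s ≡ x * A + y * B + u * C + v * D

combination-cong : ∀ {A A′ B B′ C D p q s} → A ≡ A′ → B ≡ B′ →
                   Combination A B C D p q s → Combination A′ B′ C D p q s
combination-cong refl refl c = c

combination-+ : ∀ {A B C D p q s s′} → Combination A B C D p q s → Combination A B C D p q s′ →
                Combination A B C D p q (s + s′)
combination-+ {A} {B} {C} {D} {p} {q}
  (combination x y u v u≤xp v≤yq refl) (combination x′ y′ u′ v′ u′≤x′p v′≤y′q refl) =
  combination (x + x′) (y + y′) (u + u′) (v + v′)
    (subst (u + u′ ≤_) (sym (*-distribʳ-+ p x x′)) (+-mono-≤ u≤xp u′≤x′p))
    (subst (v + v′ ≤_) (sym (*-distribʳ-+ q y y′)) (+-mono-≤ v≤yq v′≤y′q))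
    (regroup x y u v x′ y′ u′ v′ A B C D)
  where
  regroup : ∀ x y u v x′ y′ u′ v′ A B C D →
            (x * A + y * B + u * C + v * D) + (x′ * A + y′ * B + u′ * C + v′ * D)
            ≡ (x + x′) * A + (y + y′) * B + (u + u′) * C + (v + v′) * D
  regroup = solve-∀

⟨⟩-progression : ∀ {G : ℕ → Set} {A C p} → (∀ {j} → j ≤ p → G (A + j * C)) →
                 ∀ x {u} → u ≤ x * p → ⟨ G ⟩ (x * A + u * C)
⟨⟩-progression g zero    z≤n = ⟨0⟩
⟨⟩-progression {G = G} {A} {C} {p} g (suc x) {u} u≤ =
  subst ⟨ G ⟩ sum≡ (⟨+⟩ (⟨gen⟩ (g (m⊓n≤m p u))) (⟨⟩-progression g x (m≤n+o⇒m∸n≤o u p u≤)))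
  where
  open ≡-Reasoning
  sum≡ : A + p ⊓ u * C + (x * A + (u ∸ p) * C) ≡ suc x * A + u * C
  sum≡ = begin
    A + p ⊓ u * C + (x * A + (u ∸ p) * C) ≡⟨ regroup A (p ⊓ u) C x (u ∸ p) ⟩
    suc x * A + (p ⊓ u + (u ∸ p)) * C     ≡⟨ cong (λ w → suc x * A + w * C) (m⊓n+n∸m≡n p u) ⟩
    suc x * A + u * C                     ∎
    where
    regroup : ∀ A j C x r → A + j * C + (x * A + r * C) ≡ suc x * A + (j + r) * C
    regroup = solve-∀

data ParityView : ℕ → Set where
  even : ∀ j → ParityView (j * 2)
  odd  : ∀ j → ParityView (suc (j * 2))

parityView : ∀ i → ParityView i
parityView zero = even 0
parityView (suc i) with parityView i
... | even j = odd j
... | odd j  = even (suc j)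

[a+b*2]/2≡a/2+b : ∀ a b → (a + b * 2) / 2 ≡ a / 2 + b
[a+b*2]/2≡a/2+b a b = trans (+-distrib-/-∣ʳ a (divides-refl b)) (cong (a / 2 +_) (m*n/n≡m b 2))

j*2≤k⇒j≤k/2 : ∀ {j k} → j * 2 ≤ k → j ≤ k / 2
j*2≤k⇒j≤k/2 {j} j*2≤k = subst (_≤ _) (m*n/n≡m j 2) (/-monoˡ-≤ 2 j*2≤k)

j≤k/2⇒j*2≤k : ∀ {j k} → j ≤ k / 2 → j * 2 ≤ k
j≤k/2⇒j*2≤k {j} {k} j≤k/2 = ≤-trans (*-monoˡ-≤ 2 j≤k/2) (m/n*n≤m k 2)

1+j*2≤k⇒j≤[k∸1]/2 : ∀ {j k} → suc (j * 2) ≤ k → j ≤ (k ∸ 1) / 2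
1+j*2≤k⇒j≤[k∸1]/2 le = j*2≤k⇒j≤k/2 (∸-monoˡ-≤ 1 le)

j≤[k∸1]/2⇒1+j*2≤k : ∀ {j k} → 1 ≤ k → j ≤ (k ∸ 1) / 2 → suc (j * 2) ≤ k
j≤[k∸1]/2⇒1+j*2≤k {k = suc k} _ le = s≤s (j≤k/2⇒j*2≤k le)

record HalvesBounds (p q : ℕ) : Set where
  field
    1≤q   : 1 ≤ q
    q≤p   : q ≤ p
    p≤1+q : p ≤ suc q

  1≤p : 1 ≤ p
  1≤p = ≤-trans 1≤q q≤p

halves-bounds : ∀ k → 3 ≤ k → HalvesBounds (k / 2) ((k ∸ 1) / 2)
halves-bounds k = from-parity (parityView k)
  where
  bounds : ∀ {p′ q′ p q} → p′ ≡ p → q′ ≡ q → 1 ≤ q → q ≤ p → p ≤ suc q → HalvesBounds p′ q′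
  bounds refl refl 1≤q q≤p p≤1+q = record { 1≤q = 1≤q ; q≤p = q≤p ; p≤1+q = p≤1+q }
  from-parity : ∀ {k} → ParityView k → 3 ≤ k → HalvesBounds (k / 2) ((k ∸ 1) / 2)
  from-parity (even (suc (suc i))) _ =
    bounds (m*n/n≡m (suc (suc i)) 2) ([a+b*2]/2≡a/2+b 1 (suc i)) (s≤s z≤n) (n≤1+n _) ≤-refl
  from-parity (odd (suc i)) _ =
    bounds ([a+b*2]/2≡a/2+b 1 (suc i)) (m*n/n≡m (suc i) 2) (s≤s z≤n) ≤-refl (n≤1+n _)
  from-parity (even zero)       ()
  from-parity (even (suc zero)) (s≤s (s≤s ()))
  from-parity (odd zero)        (s≤s ())

gen-even : ∀ n j → gen n (j * 2) ≡ T n + j * suc n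
gen-even n j rewrite m*n%n≡0 j 2 {{_}} =
  trans (cong (_/ 2) (expand n j)) ([a+b*2]/2≡a/2+b (n * suc n) (j * suc n))
  where
  expand : ∀ n j → (n + j * 2) * (n + 0 + 1) ≡ n * suc n + j * suc n * 2
  expand = solve-∀

gen-odd : ∀ n j → gen n (suc (j * 2)) ≡ T (suc n) + j * suc (suc n)
gen-odd n j rewrite [m+kn]%n≡m%n 1 j 2 {{_}} =
  trans (cong (_/ 2) (expand n j)) ([a+b*2]/2≡a/2+b (suc n * suc (suc n)) (j * suc (suc n)))
  where
  expand : ∀ n j → (n + suc (j * 2)) * (n + 1 + 1) ≡ suc n * suc (suc n) + j * suc (suc n) * 2
  expand = solve-∀

T-double : ∀ m → T (m * 2) ≡ m * suc (m * 2)
T-double m = trans (cong (_/ 2) (expand m)) (m*n/n≡m (m * suc (m * 2)) 2)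
  where
  expand : ∀ m → m * 2 * suc (m * 2) ≡ m * suc (m * 2) * 2
  expand = solve-∀

T-double+1 : ∀ m → T (suc (m * 2)) ≡ suc (m * 2) * suc m
T-double+1 m = trans (cong (_/ 2) (expand m)) (m*n/n≡m (suc (m * 2) * suc m) 2)
  where
  expand : ∀ m → suc (m * 2) * suc (suc (m * 2)) ≡ suc (m * 2) * suc m * 2
  expand = solve-∀

Sg⇒combination : ∀ {n k s} → Sg n k s →
                 Combination (T n) (T (suc n)) (suc n) (suc (suc n)) (k / 2) ((k ∸ 1) / 2) s
Sg⇒combination ⟨0⟩ = combination 0 0 0 0 z≤n z≤n refl
Sg⇒combination {n} (⟨gen⟩ (i , i≤k , refl)) with parityView i
... | even j = combination 1 0 j 0 (subst (j ≤_) (sym (*-identityˡ _)) (j*2≤k⇒j≤k/2 i≤k)) z≤n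
      (trans (gen-even n j) (shape (T n) (T (suc n)) j (suc n) (suc (suc n))))
  where
  shape : ∀ A B j C D → A + j * C ≡ 1 * A + 0 * B + j * C + 0 * D
  shape = solve-∀
... | odd j = combination 0 1 0 j z≤n (subst (j ≤_) (sym (*-identityˡ _)) (1+j*2≤k⇒j≤[k∸1]/2 i≤k))
      (trans (gen-odd n j) (shape (T n) (T (suc n)) j (suc n) (suc (suc n))))
  where
  shape : ∀ A B j C D → B + j * D ≡ 0 * A + 1 * B + 0 * C + j * D
  shape = solve-∀
Sg⇒combination (⟨+⟩ a b) = combination-+ (Sg⇒combination a) (Sg⇒combination b)

combination⇒Sg : ∀ {n k s} → 1 ≤ k →
                 Combination (T n) (T (suc n)) (suc n) (suc (suc n)) (k / 2) ((k ∸ 1) / 2) s → Sg n k s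
combination⇒Sg {n} {k} 1≤k (combination x y u v u≤xp v≤yq refl) =
  subst (Sg n k) (regroup x (T n) u (suc n) y (T (suc n)) v (suc (suc n)))
    (⟨+⟩ (⟨⟩-progression even-gen x u≤xp) (⟨⟩-progression odd-gen y v≤yq))
  where
  even-gen : ∀ {j} → j ≤ k / 2 → Gens n k (T n + j * suc n)
  even-gen {j} j≤ = j * 2 , j≤k/2⇒j*2≤k j≤ , sym (gen-even n j)
  odd-gen : ∀ {j} → j ≤ (k ∸ 1) / 2 → Gens n k (T (suc n) + j * suc (suc n))
  odd-gen {j} j≤ = suc (j * 2) , j≤[k∸1]/2⇒1+j*2≤k 1≤k j≤ , sym (gen-odd n j)
  regroup : ∀ x A u C y B v D → x * A + u * C + (y * B + v * D) ≡ x * A + y * B + u * C + v * D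
  regroup = solve-∀

module Even {a p q X Y : ℕ} (X-ceil : IsCeiling a p X) (Y-ceil : IsCeiling (suc a * 2) q Y) where
  -- n = 2m and d = n + 1, so T n = m d, T (n+1) = d (m+1) and an element of S is
  -- (x m + y (m+1) + u) d + v (d+1).
  m = suc a
  n = m * 2
  d = suc n

  Rep : ℕ → Set
  Rep = Combination (m * d) (d * suc m) d (suc d) p q

  K : ℕ
  K = X * m + Y * suc m + suc (a * 2)

  F : ℕ
  F = n + K * d

  1+F≡ : suc F ≡ (X * m + Y * suc m + n) * d
  1+F≡ = expand a X Y
    where
    expand : ∀ a X Y →
             suc (suc (suc (a * 2)) + (X * suc a + Y * suc (suc a) + suc (a * 2)) * suc (suc (suc (a * 2))))
             ≡ (X * suc a + Y * suc (suc a) + suc (suc (a * 2))) * suc (suc (suc (a * 2)))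
    expand = solve-∀

  -- v = s mod d and y = Y; the rest of the quotient is an interval sum as it is ≥ X m.
  combination-above : ∀ {s} → F < s → Rep s
  combination-above {s} F<s = build (intervalSum-≥ {Z = X} (IsCeiling.lower X-ceil) Xm≤c′)
    where
    r = s % d
    c = s / d
    c′ = c ∸ (Y * suc m + r)
    r≤n : r ≤ n
    r≤n = ≤-pred (m%n<n s d)
    Xm+Ym+r≤c : X * m + (Y * suc m + r) ≤ c
    Xm+Ym+r≤c = begin
      X * m + (Y * suc m + r)         ≤⟨ +-monoʳ-≤ (X * m) (+-monoʳ-≤ (Y * suc m) r≤n) ⟩
      X * m + (Y * suc m + n)         ≡⟨ +-assoc (X * m) _ n ⟨
      X * m + Y * suc m + n           ≡⟨ m*n/n≡m _ d ⟨
      (X * m + Y * suc m + n) * d / d ≤⟨ /-monoˡ-≤ d (subst (_≤ s) 1+F≡ F<s) ⟩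
      c                               ∎
      where open ≤-Reasoning
    Xm≤c′ : X * m ≤ c′
    Xm≤c′ = m+n≤o⇒m≤o∸n (X * m) Xm+Ym+r≤c
    build : IntervalSum m p c′ → Rep s
    build (x , u , u≤xp , c′≡) = combination x Y u r u≤xp (≤-trans r≤n (IsCeiling.lower Y-ceil)) (begin
      s                                     ≡⟨ m≡m%n+[m/n]*n s d ⟩
      r + c * d
        ≡⟨ cong (λ c → r + c * d) (m+[n∸m]≡n (m+n≤o⇒n≤o (X * m) Xm+Ym+r≤c)) ⟨
      r + (Y * suc m + r + c′) * d          ≡⟨ cong (λ c′ → r + (Y * suc m + r + c′) * d) c′≡ ⟩
      r + (Y * suc m + r + (x * m + u)) * d ≡⟨ regroup r Y m x u d ⟩
      x * (m * d) + Y * (d * suc m) + u * d + r * suc d ∎)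
      where
      open ≡-Reasoning
      regroup : ∀ r Y m x u d → r + (Y * suc m + r + (x * m + u)) * d
                                ≡ x * (m * d) + Y * (d * suc m) + u * d + r * suc d
      regroup = solve-∀

  private
    instance
      p-nonZero : NonZero p
      p-nonZero = isCeiling⇒NonZero X-ceil
      q-nonZero : NonZero q
      q-nonZero = isCeiling⇒NonZero Y-ceil

  -- Modulo d a representation of F has v ≡ n. If v = n then y ≥ Y, leaving X m - 1 as a sum
  -- of elements of [m, m + p]; if v ≥ n + d then y, and with it the quotient, is too large.
  F≡combination⇒divMod : ∀ {x y u r t} → r < d →
                         F ≡ x * (m * d) + y * (d * suc m) + u * d + (r + t * d) * suc d →
                         n ≡ r × K ≡ x * m + y * suc m + u + r + t * suc d
  F≡combination⇒divMod {x} {y} {u} {r} {t} r<d F≡ = divMod-unique ≤-refl r<d (trans F≡ (regroup x y u r t m d))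
    where
    regroup : ∀ x y u r t m d → x * (m * d) + y * (d * suc m) + u * d + (r + t * d) * suc d
                                ≡ r + (x * m + y * suc m + u + r + t * suc d) * d
    regroup = solve-∀

  K≢-v≡n : ∀ {x y u} → u ≤ x * p → n ≤ y * q → K ≢ x * m + y * suc m + u + n
  K≢-v≡n {x} {y} {u} u≤xp n≤yq K≡ with m≤n⇒∃[o]m+o≡n (isCeiling-minimal {y = y} Y-ceil n≤yq)
  ... | j , refl = intervalSum-gap {Z = X} (IsCeiling.upper X-ceil) (sym Xm≡) (x + j , j + u , j+u≤[x+j]p , refl)
    where
    open ≡-Reasoning
    Xm≡ : X * m ≡ suc ((x + j) * m + (j + u))
    Xm≡ = +-cancelʳ-≡ (Y * suc m + suc (a * 2)) _ _ (begin
      X * m + (Y * suc m + suc (a * 2))                       ≡⟨ +-assoc (X * m) _ _ ⟨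
      K                                                       ≡⟨ K≡ ⟩
      x * m + (Y + j) * suc m + u + n                         ≡⟨ regroup a x Y j u ⟩
      suc ((x + j) * m + (j + u)) + (Y * suc m + suc (a * 2)) ∎)
      where
      regroup : ∀ a x Y j u → x * suc a + (Y + j) * suc (suc a) + u + suc a * 2
                              ≡ suc ((x + j) * suc a + (j + u)) + (Y * suc (suc a) + suc (a * 2))
      regroup = solve-∀
    j+u≤[x+j]p : j + u ≤ (x + j) * p
    j+u≤[x+j]p = subst (j + u ≤_) (trans (+-comm (j * p) _) (sym (*-distribʳ-+ p x j))) (+-mono-≤ (m≤m*n j p) u≤xp)

  K≢-v>d : q ≤ p → p ≤ suc q → ∀ {x y u t} → n + suc t * d ≤ y * q →
           K ≢ x * m + y * suc m + u + n + suc t * suc d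
  K≢-v>d q≤p p≤1+q {x} {y} {u} {t} v≤yq K≡ = <-irrefl K≡ (begin-strict
    K                                                 ≤⟨ +-monoˡ-≤ _ (+-monoˡ-≤ _ (*-monoʳ-≤ X (n≤1+n m))) ⟩
    X * suc m + Y * suc m + suc (a * 2)               ≡⟨ cong (_+ suc (a * 2)) (*-distribʳ-+ (suc m) X Y) ⟨
    (X + Y) * suc m + suc (a * 2)                     ≤⟨ +-monoˡ-≤ _ (*-monoˡ-≤ (suc m) X+Y≤y+2) ⟩
    (y + 2) * suc m + suc (a * 2)                     <⟨ n<1+n _ ⟩
    suc ((y + 2) * suc m + suc (a * 2))               ≡⟨ expand a y ⟩
    y * suc m + (n + suc d)                           ≤⟨ m≤m+n _ _ ⟩
    y * suc m + (n + suc d) + (x * m + u + t * suc d) ≡⟨ regroup x y u n t m d ⟩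
    x * m + y * suc m + u + n + suc t * suc d         ∎)
    where
    open ≤-Reasoning
    expand : ∀ a y → suc ((y + 2) * suc (suc a) + suc (a * 2))
                     ≡ y * suc (suc a) + (suc a * 2 + suc (suc (suc a * 2)))
    expand = solve-∀
    regroup : ∀ x y u n t m d → y * suc m + (n + suc d) + (x * m + u + t * suc d)
                                ≡ x * m + y * suc m + u + n + suc t * suc d
    regroup = solve-∀
    a≤[1+t]d : a ≤ suc t * d
    a≤[1+t]d = ≤-trans (m≤m*n a 2) (≤-trans (≤-trans (n≤1+n _) (≤-trans (n≤1+n _) (n≤1+n _))) (m≤m+n d (t * d)))
    Xp≤a+q : X * p ≤ a + q
    Xp≤a+q = ≤-pred (≤-trans (IsCeiling.upper X-ceil) (≤-trans (+-monoʳ-≤ a p≤1+q) (≤-reflexive (+-suc a q))))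
    X+Y≤y+2 : X + Y ≤ y + 2
    X+Y≤y+2 = *-cancelʳ-≤ (X + Y) (y + 2) q (begin
      (X + Y) * q         ≡⟨ *-distribʳ-+ q X Y ⟩
      X * q + Y * q       ≤⟨ +-monoˡ-≤ _ (*-monoʳ-≤ X q≤p) ⟩
      X * p + Y * q       ≤⟨ +-mono-≤ Xp≤a+q (<⇒≤ (IsCeiling.upper Y-ceil)) ⟩
      a + q + (n + q)     ≡⟨ shuffle a q n ⟩
      n + a + q + q       ≤⟨ +-monoˡ-≤ q (+-monoˡ-≤ q (≤-trans (+-monoʳ-≤ n a≤[1+t]d) v≤yq)) ⟩
      y * q + q + q       ≡⟨ collect y q ⟩
      (y + 2) * q         ∎)
      where
      shuffle : ∀ a q n → a + q + (n + q) ≡ n + a + q + q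
      shuffle = solve-∀
      collect : ∀ y q → y * q + q + q ≡ (y + 2) * q
      collect = solve-∀

  K≢ : q ≤ p → p ≤ suc q → ∀ {x y u t} → u ≤ x * p → n + t * d ≤ y * q →
       K ≢ x * m + y * suc m + u + n + t * suc d
  K≢ _ _ {x} {y} {u} {zero} u≤xp v≤yq K≡ =
    K≢-v≡n {x} {y} {u} u≤xp (subst (_≤ y * q) (+-identityʳ n) v≤yq) (trans K≡ (+-identityʳ _))
  K≢ q≤p p≤1+q {x} {y} {u} {suc t} _ v≤yq K≡ = K≢-v>d q≤p p≤1+q {x} {y} {u} {t} v≤yq K≡

  frobenius-∉ : q ≤ p → p ≤ suc q → ¬ Rep F
  frobenius-∉ q≤p p≤1+q (combination x y u v u≤xp v≤yq F≡) =
    K≢ q≤p p≤1+q {x} {y} {u} {t} u≤xp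
      (subst (λ r → r + t * d ≤ y * q) (sym (proj₁ divMod)) (subst (_≤ y * q) v≡ v≤yq))
      (subst (λ r → K ≡ x * m + y * suc m + u + r + t * suc d) (sym (proj₁ divMod)) (proj₂ divMod))
    where
    r = v % d
    t = v / d
    v≡ : v ≡ r + t * d
    v≡ = m≡m%n+[m/n]*n v d
    divMod = F≡combination⇒divMod {x} {y} {u} {r} {t} (m%n<n v d)
               (subst (λ v → F ≡ x * (m * d) + y * (d * suc m) + u * d + v * suc d) v≡ F≡)

module Odd {b p q X Y : ℕ} (X-ceil : IsCeiling (suc b * 2) p X) (Y-ceil : IsCeiling (suc b) q Y) where
  -- n = 2m + 1 and e = n + 2, so T n = m e + 1, T (n+1) = (m+1) e and an element s of S
  -- satisfies s + u = (m x + (m+1) y + u + v) e + x.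
  m = suc b
  n = suc (m * 2)
  e = suc (suc n)

  Rep : ℕ → Set
  Rep = Combination (n * suc m) (suc m * e) (suc n) e p q

  B : ℕ
  B = m * X + Y * suc m + suc (b * 2)

  F : ℕ
  F = X + 2 + B * e

  -- s = r + c e: for r ≤ X + 2 take x = r and u = 0, otherwise x = X and u = X + e - r.
  above-residue≤X+2 : ∀ {r c} → r ≤ X + 2 → F < r + c * e → Rep (r + c * e)
  above-residue≤X+2 {r} {c} r≤X+2 F<s =
    build (intervalSum-≥ {Z = Y} (IsCeiling.lower Y-ceil) (m+n≤o⇒m≤o∸n (Y * suc m) Ym+mr≤c))
    where
    B<c : B < c
    B<c = *-cancelʳ-< e B c (+-cancelˡ-≤ (X + 2) _ _ (begin
      X + 2 + suc (B * e) ≡⟨ +-suc (X + 2) (B * e) ⟩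
      suc (X + 2) + B * e ≤⟨ F<s ⟩
      r + c * e           ≤⟨ +-monoˡ-≤ (c * e) r≤X+2 ⟩
      X + 2 + c * e       ∎))
      where open ≤-Reasoning
    Ym+mr≤c : Y * suc m + m * r ≤ c
    Ym+mr≤c = begin
      Y * suc m + m * r       ≤⟨ +-monoʳ-≤ (Y * suc m) (*-monoʳ-≤ m r≤X+2) ⟩
      Y * suc m + m * (X + 2) ≡⟨ expand b X Y ⟩
      suc B                   ≤⟨ B<c ⟩
      c                       ∎
      where
      open ≤-Reasoning
      expand : ∀ b X Y → Y * suc (suc b) + suc b * (X + 2) ≡ suc (suc b * X + Y * suc (suc b) + suc (b * 2))
      expand = solve-∀
    build : IntervalSum (suc m) q (c ∸ m * r) → Rep (r + c * e)
    build (y , v , v≤yq , c′≡) = combination r y 0 v z≤n v≤yq (begin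
      r + c * e
        ≡⟨ cong (λ c → r + c * e) (m+[n∸m]≡n (m+n≤o⇒n≤o (Y * suc m) Ym+mr≤c)) ⟨
      r + (m * r + (c ∸ m * r)) * e       ≡⟨ cong (λ c′ → r + (m * r + c′) * e) c′≡ ⟩
      r + (m * r + (y * suc m + v)) * e   ≡⟨ regroup b r y v ⟩
      r * (n * suc m) + y * (suc m * e) + 0 * suc n + v * e ∎)
      where
      open ≡-Reasoning
      regroup : ∀ b r y v → r + (suc b * r + (y * suc (suc b) + v)) * suc (suc (suc (suc b * 2)))
                            ≡ r * (suc (suc b * 2) * suc (suc b)) + y * (suc (suc b) * suc (suc (suc (suc b * 2))))
                              + 0 * suc (suc (suc b * 2)) + v * suc (suc (suc (suc b * 2)))
      regroup = solve-∀

  above-residue>X+2 : ∀ {r c} → X + 2 < r → r < e → F < r + c * e → Rep (r + c * e)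
  above-residue>X+2 {r} {c} X+2<r r<e F<s with m≤n⇒∃[o]m+o≡n X+2<r | m≤n⇒∃[o]m+o≡n r<e
  ... | h , refl | g , e≡ =
    build (intervalSum-≥ {Z = Y} (IsCeiling.lower Y-ceil) (m+n≤o⇒m≤o∸n (Y * suc m) Ym+[1+m]X+g≤c))
    where
    X+g+h≡ : X + g + h ≡ suc (b * 2)
    X+g+h≡ = +-cancelˡ-≡ 4 _ _ (trans (shape X g h) e≡)
      where
      shape : ∀ X g h → 4 + (X + g + h) ≡ suc (suc (X + 2) + h) + g
      shape = solve-∀
    B≤c : B ≤ c
    B≤c = b*e≤r+c*e⇒b≤c r<e (≤-trans (m≤n+m (B * e) (suc (X + 2))) F<s)
    Ym+[1+m]X+g≤c : Y * suc m + (suc m * X + g) ≤ c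
    Ym+[1+m]X+g≤c = begin
      Y * suc m + (suc m * X + g)     ≤⟨ m≤m+n _ h ⟩
      Y * suc m + (suc m * X + g) + h ≡⟨ regroup b X Y g h ⟩
      m * X + Y * suc m + (X + g + h) ≡⟨ cong (m * X + Y * suc m +_) X+g+h≡ ⟩
      B                               ≤⟨ B≤c ⟩
      c                               ∎
      where
      open ≤-Reasoning
      regroup : ∀ b X Y g h → Y * suc (suc b) + (suc (suc b) * X + g) + h ≡ suc b * X + Y * suc (suc b) + (X + g + h)
      regroup = solve-∀
    u≤Xp : X + g + 1 ≤ X * p
    u≤Xp = ≤-trans (≤-trans (≤-reflexive (+-comm (X + g) 1)) (s≤s (m≤m+n (X + g) h)))
                   (≤-trans (≤-reflexive (cong suc X+g+h≡)) (IsCeiling.lower X-ceil))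
    build : IntervalSum (suc m) q (c ∸ (suc m * X + g)) → Rep (suc (X + 2) + h + c * e)
    build (y , v , v≤yq , c′≡) = combination X y (X + g + 1) v u≤Xp v≤yq (begin
      suc (X + 2) + h + c * e
        ≡⟨ cong (λ c → suc (X + 2) + h + c * e) (m+[n∸m]≡n (m+n≤o⇒n≤o (Y * suc m) Ym+[1+m]X+g≤c)) ⟨
      suc (X + 2) + h + (suc m * X + g + (c ∸ (suc m * X + g))) * e
        ≡⟨ cong (λ c′ → suc (X + 2) + h + (suc m * X + g + c′) * e) c′≡ ⟩
      suc (X + 2) + h + (suc m * X + g + (y * suc m + v)) * e
        ≡⟨ +-cancelʳ-≡ (X + g + h) _ _ (trans (cong (lhs +_) X+g+h≡) (regroup b X g h y v)) ⟩
      X * (n * suc m) + y * (suc m * e) + (X + g + 1) * suc n + v * e ∎)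
      where
      open ≡-Reasoning
      lhs = suc (X + 2) + h + (suc m * X + g + (y * suc m + v)) * e
      regroup : ∀ b X g h y v →
                suc (X + 2) + h + (suc (suc b) * X + g + (y * suc (suc b) + v)) * suc (suc (suc (suc b * 2))) + suc (b * 2)
                ≡ X * (suc (suc b * 2) * suc (suc b)) + y * (suc (suc b) * suc (suc (suc (suc b * 2))))
                  + (X + g + 1) * suc (suc (suc b * 2)) + v * suc (suc (suc (suc b * 2))) + (X + g + h)
      regroup = solve-∀

  combination-above : ∀ {s} → F < s → Rep s
  combination-above {s} F<s with s % e ≤? X + 2
  ... | yes r≤X+2 = subst Rep (sym s≡) (above-residue≤X+2 {s % e} {s / e} r≤X+2 (subst (F <_) s≡ F<s))
    where s≡ = m≡m%n+[m/n]*n s e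
  ... | no r≰X+2 =
    subst Rep (sym s≡) (above-residue>X+2 {s % e} {s / e} (≰⇒> r≰X+2) (m%n<n s e) (subst (F <_) s≡ F<s))
    where s≡ = m≡m%n+[m/n]*n s e

  private
    instance
      p-nonZero : NonZero p
      p-nonZero = isCeiling⇒NonZero X-ceil

  combination+u : ∀ {s x y u v} → s ≡ x * (n * suc m) + y * (suc m * e) + u * suc n + v * e →
                  s + u ≡ (m * x + y * suc m + u + v) * e + x
  combination+u {x = x} {y} {u} {v} refl = regroup b x y u v
    where
    regroup : ∀ b x y u v → x * (suc (suc b * 2) * suc (suc b)) + y * (suc (suc b) * suc (suc (suc (suc b * 2))))
                            + u * suc (suc (suc b * 2)) + v * suc (suc (suc (suc b * 2))) + u
                            ≡ (suc b * x + y * suc (suc b) + u + v) * suc (suc (suc (suc b * 2))) + x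
    regroup = solve-∀

  -- F + u = B e + (X + 2 + u), so either x = X + 2 + u + J e, or X + 2 + u = x + J e with J ≥ 1.
  F+u≢-without-carry : ∀ {x y u v} → v ≤ y * q → X + 2 + u ≤ x →
                       F + u ≢ (m * x + y * suc m + u + v) * e + x
  F+u≢-without-carry {x} {y} {u} {v} v≤yq X+2+u≤x eq with m≤n⇒∃[o]m+o≡n X+2+u≤x
  ... | a′ , refl with m*d≡n*d+r⇒∃[j]m≡n+j×r≡j*d B Q e Be≡Qe+a′
    where
    Q = m * x + y * suc m + u + v
    Be≡Qe+a′ : B * e ≡ Q * e + a′
    Be≡Qe+a′ = +-cancelʳ-≡ (X + 2 + u) _ _
                 (trans (shuffle₁ (B * e) X u) (trans eq (shuffle₂ (Q * e) (X + 2 + u) a′)))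
      where
      shuffle₁ : ∀ Z X u → Z + (X + 2 + u) ≡ X + 2 + Z + u
      shuffle₁ = solve-∀
      shuffle₂ : ∀ Z w a → Z + (w + a) ≡ Z + a + w
      shuffle₂ = solve-∀
  ... | J , B≡Q+J , a′≡Je =
    intervalSum-gap {Z = Y} (IsCeiling.upper Y-ceil) (sym Ym≡) (u + y + J * n , v , v≤[u+y+Jn]q , refl)
    where
    open ≡-Reasoning
    Ym≡ : Y * suc m ≡ suc ((u + y + J * n) * suc m + v)
    Ym≡ = +-cancelʳ-≡ B _ _ (begin
      Y * suc m + B
        ≡⟨ cong (Y * suc m +_) B≡Q+J ⟩
      Y * suc m + (m * (X + 2 + u + a′) + y * suc m + u + v + J)
        ≡⟨ cong (λ a → Y * suc m + (m * (X + 2 + u + a) + y * suc m + u + v + J)) a′≡Je ⟩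
      Y * suc m + (m * (X + 2 + u + J * e) + y * suc m + u + v + J)
        ≡⟨ regroup b X Y u J y v ⟩
      suc ((u + y + J * n) * suc m + v) + B ∎)
      where
      regroup : ∀ b X Y u J y v →
                Y * suc (suc b) + (suc b * (X + 2 + u + J * suc (suc (suc (suc b * 2)))) + y * suc (suc b) + u + v + J)
                ≡ suc ((u + y + J * suc (suc b * 2)) * suc (suc b) + v) + (suc b * X + Y * suc (suc b) + suc (b * 2))
      regroup = solve-∀
    v≤[u+y+Jn]q : v ≤ (u + y + J * n) * q
    v≤[u+y+Jn]q = ≤-trans v≤yq (*-monoˡ-≤ q (≤-trans (m≤n+m y u) (m≤m+n (u + y) (J * n))))

  carry⇒X≤x : ∀ {x u J} → u ≤ x * p → X + 2 + u ≡ x + suc J * e → X ≤ x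
  carry⇒X≤x {x} {u} {J} u≤xp eq with X ≤? x
  ... | yes X≤x = X≤x
  ... | no X≰x = contradiction (≤-<-trans m*2≤[x+g]p [x+g]p<m*2) (<-irrefl refl)
    where
    open ≤-Reasoning
    g = X ∸ suc x
    X≡ : X ≡ suc x + g
    X≡ = sym (m+[n∸m]≡n (≰⇒> X≰x))
    [x+g]p<m*2 : (x + g) * p < m * 2
    [x+g]p<m*2 = +-cancelʳ-< p _ _ (begin-strict
      (x + g) * p + p ≡⟨ +-comm _ p ⟩
      (suc x + g) * p ≡⟨ cong (_* p) X≡ ⟨
      X * p           <⟨ IsCeiling.upper X-ceil ⟩
      m * 2 + p       ∎)
    m*2≤g+xp : m * 2 ≤ g + x * p
    m*2≤g+xp = +-cancelʳ-≤ (x + 3) _ _ (begin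
      m * 2 + (x + 3)     ≡⟨ shuffle₁ b x ⟩
      x + e               ≤⟨ +-monoʳ-≤ x (m≤m+n e (J * e)) ⟩
      x + suc J * e       ≡⟨ eq ⟨
      X + 2 + u           ≡⟨ cong (λ X → X + 2 + u) X≡ ⟩
      suc x + g + 2 + u   ≡⟨ shuffle₂ x g u ⟩
      g + u + (x + 3)     ≤⟨ +-monoˡ-≤ (x + 3) (+-monoʳ-≤ g u≤xp) ⟩
      g + x * p + (x + 3) ∎)
      where
      shuffle₁ : ∀ b x → suc b * 2 + (x + 3) ≡ x + suc (suc (suc (suc b * 2)))
      shuffle₁ = solve-∀
      shuffle₂ : ∀ x g u → suc x + g + 2 + u ≡ g + u + (x + 3)
      shuffle₂ = solve-∀
    m*2≤[x+g]p : m * 2 ≤ (x + g) * p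
    m*2≤[x+g]p = begin
      m * 2         ≤⟨ m*2≤g+xp ⟩
      g + x * p     ≤⟨ +-monoˡ-≤ (x * p) (m≤m*n g p) ⟩
      g * p + x * p ≡⟨ *-distribʳ-+ p g x ⟨
      (g + x) * p   ≡⟨ cong (_* p) (+-comm g x) ⟩
      (x + g) * p   ∎

  carry-≢ : ∀ {x y v J} → v ≤ y * q → X ≤ x →
               (X + Y + 2) * suc m ≢ suc ((x + y + suc J + suc J) * suc m + v)
  carry-≢ {x} {y} {v} {J} v≤yq X≤x H = contradiction (begin-strict
    X + Y + 2                 ≤⟨ +-monoˡ-≤ 2 (+-mono-≤ X≤x Y≤y) ⟩
    x + y + 2                 ≡⟨ +-assoc (x + y) 1 1 ⟨
    x + y + 1 + 1             ≤⟨ +-mono-≤ (+-monoʳ-≤ (x + y) (s≤s z≤n)) (s≤s z≤n) ⟩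
    x + y + suc J + suc J     <⟨ proj₂ m≤v×t<Z ⟩
    X + Y + 2                 ∎) (<-irrefl refl)
    where
    open ≤-Reasoning
    m≤v×t<Z = z*[1+m]≡1+t*[1+m]+v⇒m≤v×t<z H
    Y≤y : Y ≤ y
    Y≤y = isCeiling-minimal Y-ceil (≤-trans (proj₁ m≤v×t<Z) v≤yq)

  F+u≢-with-carry : ∀ {x y u v} → u ≤ x * p → v ≤ y * q → x < X + 2 + u →
                    F + u ≢ (m * x + y * suc m + u + v) * e + x
  F+u≢-with-carry {x} {y} {u} {v} u≤xp v≤yq x<X+2+u eq
    with m≤n⇒∃[o]m+o≡n x<X+2+u
  ... | c , 1+x+c≡ with m*d≡n*d+r⇒∃[j]m≡n+j×r≡j*d Q B e Qe≡Be+1+c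
    where
    Q = m * x + y * suc m + u + v
    Qe≡Be+1+c : Q * e ≡ B * e + suc c
    Qe≡Be+1+c = +-cancelʳ-≡ x _ _ (begin
      Q * e + x             ≡⟨ eq ⟨
      X + 2 + B * e + u     ≡⟨ shuffle₁ X (B * e) u ⟩
      B * e + (X + 2 + u)   ≡⟨ cong (B * e +_) 1+x+c≡ ⟨
      B * e + (suc x + c)   ≡⟨ shuffle₂ (B * e) x c ⟩
      B * e + suc c + x     ∎)
      where
      open ≡-Reasoning
      shuffle₁ : ∀ X Z u → X + 2 + Z + u ≡ Z + (X + 2 + u)
      shuffle₁ = solve-∀
      shuffle₂ : ∀ Z x c → Z + (suc x + c) ≡ Z + suc c + x
      shuffle₂ = solve-∀
  ... | zero  , _ , ()
  ... | suc J , Q≡B+J , 1+c≡Je = carry-≢ {x} {y} {v} {J} v≤yq (carry⇒X≤x {x} {u} {J} u≤xp X+2+u≡) H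
    where
    open ≡-Reasoning
    X+2+u≡ : X + 2 + u ≡ x + suc J * e
    X+2+u≡ = trans (sym 1+x+c≡) (trans (sym (+-suc x c)) (cong (x +_) 1+c≡Je))
    H : (X + Y + 2) * suc m ≡ suc ((x + y + suc J + suc J) * suc m + v)
    H = +-cancelʳ-≡ (B + suc J + (X + 2 + u)) _ _ (begin
      (X + Y + 2) * suc m + (B + suc J + (X + 2 + u))
        ≡⟨ cong₂ (λ Q w → (X + Y + 2) * suc m + (Q + w)) Q≡B+J (sym X+2+u≡) ⟨
      (X + Y + 2) * suc m + (m * x + y * suc m + u + v + (x + suc J * e))
        ≡⟨ regroup b X Y x y u v J ⟩
      suc ((x + y + suc J + suc J) * suc m + v) + (B + suc J + (X + 2 + u)) ∎)
      where
      regroup : ∀ b X Y x y u v J →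
                (X + Y + 2) * suc (suc b) + (suc b * x + y * suc (suc b) + u + v + (x + suc J * suc (suc (suc (suc b * 2)))))
                ≡ suc ((x + y + suc J + suc J) * suc (suc b) + v)
                  + (suc b * X + Y * suc (suc b) + suc (b * 2) + suc J + (X + 2 + u))
      regroup = solve-∀

  frobenius-∉ : ¬ Rep F
  frobenius-∉ (combination x y u v u≤xp v≤yq F≡) with X + 2 + u ≤? x
  ... | yes X+2+u≤x = F+u≢-without-carry {x} {y} {u} {v} v≤yq X+2+u≤x F+u≡
    where F+u≡ = combination+u {F} {x} {y} {u} {v} F≡
  ... | no X+2+u≰x  = F+u≢-with-carry {x} {y} {u} {v} u≤xp v≤yq (≰⇒> X+2+u≰x) F+u≡
    where F+u≡ = combination+u {F} {x} {y} {u} {v} F≡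

theorem1p3-even : ∀ a k → 3 ≤ k → let n = suc a * 2 in
                  IsNumericalSemigroup (Sg n k) × IsFrobeniusNumber (Sg n k) (frob n k)
theorem1p3-even a k 3≤k =
  isNumericalSemigroup-⟨⟩ (suc F) (λ s → in-S) ,
  subst (IsFrobeniusNumber (Sg n k)) (sym frob≡F) (isFrobeniusNumber-+ F∉S (λ s → in-S))
  where
  n = suc a * 2
  p = k / 2
  q = (k ∸ 1) / 2
  open HalvesBounds (halves-bounds k 3≤k)
  X = ceilDiv (a * 2) (2 * p)
  Y = ceilDiv n q
  X-ceil : IsCeiling a p X
  X-ceil = isCeiling-cancel 2 (ceilDiv-isCeiling _ _ (≤-trans 1≤p (m≤m+n p _)))
  Y-ceil : IsCeiling n q Y
  Y-ceil = ceilDiv-isCeiling n q 1≤q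
  open Even X-ceil Y-ceil using (F; 1+F≡; combination-above; frobenius-∉)
  F∉S : ¬ Sg n k F
  F∉S F∈S = frobenius-∉ q≤p p≤1+q
    (combination-cong (T-double (suc a)) (T-double+1 (suc a)) (Sg⇒combination {n} {k} F∈S))
  in-S : ∀ {s} → F < s → Sg n k s
  in-S {s} F<s = combination⇒Sg {n} {k} {s} (≤-trans (s≤s z≤n) 3≤k)
    (combination-cong (sym (T-double (suc a))) (sym (T-double+1 (suc a))) (combination-above F<s))
  N≡1+F : X * T n + Y * T (suc n) + n * n + n ≡ suc F
  N≡1+F rewrite T-double (suc a) | T-double+1 (suc a) = trans (expand a X Y) (sym 1+F≡)
    where
    expand : ∀ a X Y → X * (suc a * suc (suc a * 2)) + Y * (suc (suc a * 2) * suc (suc a))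
                       + suc a * 2 * (suc a * 2) + suc a * 2
                       ≡ (X * suc a + Y * suc (suc a) + suc a * 2) * suc (suc a * 2)
    expand = solve-∀
  frob≡F : frob n k ≡ ℤ.+ F
  frob≡F rewrite m*n%n≡0 (suc a) 2 {{_}} = cong (λ N → ℤ.+ N ℤ.- ℤ.+ 1) N≡1+F

theorem1p3-odd : ∀ b k → 3 ≤ k → let n = suc (suc b * 2) in
                 IsNumericalSemigroup (Sg n k) × IsFrobeniusNumber (Sg n k) (frob n k)
theorem1p3-odd b k 3≤k =
  isNumericalSemigroup-⟨⟩ (suc F) (λ s → in-S) ,
  subst (IsFrobeniusNumber (Sg n k)) (sym frob≡F) (isFrobeniusNumber-+ F∉S (λ s → in-S))
  where
  m = suc b
  n = suc (m * 2)
  p = k / 2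
  q = (k ∸ 1) / 2
  open HalvesBounds (halves-bounds k 3≤k)
  X = ceilDiv (m * 2) p
  Y = ceilDiv (m * 2) (2 * q)
  X-ceil : IsCeiling (m * 2) p X
  X-ceil = ceilDiv-isCeiling _ _ 1≤p
  Y-ceil : IsCeiling m q Y
  Y-ceil = isCeiling-cancel 2 (ceilDiv-isCeiling _ _ (≤-trans 1≤q (m≤m+n q _)))
  open Odd X-ceil Y-ceil using (F; combination-above; frobenius-∉)
  F∉S : ¬ Sg n k F
  F∉S F∈S = frobenius-∉ (combination-cong (T-double+1 m) (T-double (suc m)) (Sg⇒combination {n} {k} F∈S))
  in-S : ∀ {s} → F < s → Sg n k s
  in-S {s} F<s = combination⇒Sg {n} {k} {s} (≤-trans (s≤s z≤n) 3≤k)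
    (combination-cong (sym (T-double+1 m)) (sym (T-double (suc m))) (combination-above F<s))
  N≡2+F : X * T n + Y * T (suc n) + n * n ≡ suc (suc F)
  N≡2+F rewrite T-double+1 m | T-double (suc m) = expand b X Y
    where
    expand : ∀ b X Y → X * (suc (suc b * 2) * suc (suc b)) + Y * (suc (suc b) * suc (suc (suc b) * 2))
                       + suc (suc b * 2) * suc (suc b * 2)
                       ≡ suc (suc (X + 2 + (suc b * X + Y * suc (suc b) + suc (b * 2)) * suc (suc (suc (suc b * 2)))))
    expand = solve-∀
  frob≡F : frob n k ≡ ℤ.+ F
  frob≡F rewrite [m+kn]%n≡m%n 1 m 2 {{_}} = cong (λ N → ℤ.+ N ℤ.- ℤ.+ 2) N≡2+F

theorem1p3-one : ∀ k → 3 ≤ k → IsNumericalSemigroup (Sg 1 k) × IsFrobeniusNumber (Sg 1 k) (frob 1 k)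
theorem1p3-one k 3≤k =
  isNumericalSemigroup-⟨⟩ 0 (λ s _ → all s) ,
  subst (IsFrobeniusNumber (Sg 1 k)) (sym frob≡-1) (isFrobeniusNumber-ℕ all)
  where
  open HalvesBounds (halves-bounds k 3≤k)
  all : ∀ s → Sg 1 k s
  all zero    = ⟨0⟩
  all (suc s) = ⟨+⟩ (⟨gen⟩ (0 , z≤n , refl)) (all s)
  ceilDiv0≡0 : ∀ b → 1 ≤ b → ceilDiv 0 b ≡ 0
  ceilDiv0≡0 (suc b) _ = m<n⇒m/n≡0 (n<1+n b)
  frob≡-1 : frob 1 k ≡ ℤ.-[1+ 0 ]
  frob≡-1 rewrite ceilDiv0≡0 (k / 2) 1≤p | ceilDiv0≡0 (2 * ((k ∸ 1) / 2)) (≤-trans 1≤q (m≤m+n _ _)) = refl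

theorem1p3 : (n k : ℕ) → n ≥ 1 → k ≥ 3 →
    IsNumericalSemigroup (Sg n k) × IsFrobeniusNumber (Sg n k) (frob n k)
theorem1p3 n k n≥1 k≥3 with parityView n
... | even zero    = contradiction n≥1 λ ()
... | even (suc a) = theorem1p3-even a k k≥3
... | odd zero     = theorem1p3-one k k≥3
... | odd (suc b)  = theorem1p3-odd b k k≥3
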